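{- Let $G$ be a graph on the vertex set $V=\{1,\dots,n\}$, let $N=\binom{n}{2}$, and let $\alpha$ be an integer with $\alpha > N$. For each $i\in\{0,1,\dots,N\}$ let $d_i$ denote the number of triangle-free subgraphs of $G$ with exactly $i$ edges (i.e. edge subsets $F\subseteq E(G)$ with $|F|=i$ such that $(V,F)$ contains no triangle). Let $Z$ be the partition function of $\mathrm{TRIFREE}(G,\alpha)$. Then \[ \lfloor Z\rfloor = \sum_{i=0}^{N} d_i\, 2^{i\alpha}, \qquad 0\le d_i < 2^{\alpha}\ \text{for all } i, \] that is, the integer part of $Z$ written in base $2^{\alpha}$ has digits $d_N\dots d_2d_1d_0$.
   Context: An exponential random graph model (ERGM) on the vertex set $V=\{1,\dots,n\}$ is given by a finite list of features $f$, each a function from the set of all simple graphs on $V$ to the nonnegative integers, together with a real (here integer) weight $w_f$ for each feature. The density of a graph $H$ on $V$ is $d(H)=\prod_f 2^{f(H)w_f}$, the partition function is $Z=\sum_H d(H)$ (sum over all $2^{\binom n2}$ simple graphs on $V$), and the probability of $H$ is $d(H)/Z$. For a graph $G$ on $V$ and a number $\alpha$, $\mathrm{TRIFREE}(G,\alpha)$ is the ERGM with the following features: for each unordered pair $\{u,v\}$ of distinct vertices, a $0$-$1$ indicator feature that is $1$ iff $\{u,v\}$ is an edge of $H$, with weight $\alpha$ if $\{u,v\}\in E(G)$ and weight $\beta=-\binom n2\alpha-\binom n2-1$ if $\{u,v\}\notin E(G)$; and one feature counting the number of triangles (3-vertex complete subgraphs) in $H$, with weight $\beta$. -}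

module Defs where

open import Data.Bool using (Bool; true; false; _∧_; _∨_; not; if_then_else_)
open import Data.Nat using (ℕ; zero; suc; _<ᵇ_; _≡ᵇ_; _^_)
import Data.Nat as ℕ
open import Data.Nat.Properties using (m^n≢0)
open import Data.Nat.Combinatorics using (_C_)
open import Data.Integer using (ℤ; +_; -[1+_])
import Data.Integer as ℤ
open import Data.Rational using (ℚ; 0ℚ)
import Data.Rational as ℚ
open import Data.Fin using (Fin; toℕ)
open import Data.List using (List; []; _∷_; length; allFin; filterᵇ; cartesianProduct; concatMap; map)
open import Data.Bool.ListAction using (any)
open import Data.Vec using (Vec; []; _∷_)
open import Data.Product using (_×_; _,_; proj₁; proj₂)
open import Relation.Nullary.Decidable using (⌊_⌋)
import Data.Fin.Properties as FinP

-- Unordered pairs {u,v} of distinct vertices of V = Fin n, each listed once as (u , v) with u < v.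
pairs : (n : ℕ) → List (Fin n × Fin n)
pairs n = filterᵇ (λ p → toℕ (proj₁ p) <ᵇ toℕ (proj₂ p)) (cartesianProduct (allFin n) (allFin n))

-- A simple graph on V: for each unordered pair (in the order of `pairs n`), whether it is an edge.
record Graph (n : ℕ) : Set where
  constructor mkGraph
  field bits : Vec Bool (length (pairs n))
open Graph public

allVecs : (k : ℕ) → List (Vec Bool k)
allVecs zero = [] ∷ []
allVecs (suc k) = concatMap (λ v → (false ∷ v) ∷ (true ∷ v) ∷ []) (allVecs k)

allGraphs : (n : ℕ) → List (Graph n)
allGraphs n = map mkGraph (allVecs (length (pairs n)))

select : {A : Set} (xs : List A) → Vec Bool (length xs) → List A
select [] [] = []
select (x ∷ xs) (true ∷ bs) = x ∷ select xs bs
select (x ∷ xs) (false ∷ bs) = select xs bs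

edges : {n : ℕ} → Graph n → List (Fin n × Fin n)
edges {n} H = select (pairs n) (bits H)

_=F_ : {n : ℕ} → Fin n → Fin n → Bool
a =F b = ⌊ a FinP.≟ b ⌋

adj : {n : ℕ} → Graph n → Fin n → Fin n → Bool
adj H u v = any (λ p → ((proj₁ p =F u) ∧ (proj₂ p =F v)) ∨ ((proj₁ p =F v) ∧ (proj₂ p =F u))) (edges H)

triples : (n : ℕ) → List (Fin n × Fin n × Fin n)
triples n = filterᵇ (λ t → (toℕ (proj₁ t) <ᵇ toℕ (proj₁ (proj₂ t))) ∧ (toℕ (proj₁ (proj₂ t)) <ᵇ toℕ (proj₂ (proj₂ t))))
  (cartesianProduct (allFin n) (cartesianProduct (allFin n) (allFin n)))

triangles : {n : ℕ} → Graph n → ℕ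
triangles {n} H = length (filterᵇ (λ t → adj H (proj₁ t) (proj₁ (proj₂ t)) ∧ adj H (proj₁ (proj₂ t)) (proj₂ (proj₂ t)) ∧ adj H (proj₁ t) (proj₂ (proj₂ t))) (triples n))

triangleFree : {n : ℕ} → Graph n → Bool
triangleFree H = triangles H ≡ᵇ 0

subVec : {k : ℕ} → Vec Bool k → Vec Bool k → Bool
subVec [] [] = true
subVec (h ∷ hs) (g ∷ gs) = (not h ∨ g) ∧ subVec hs gs

isSubgraph : {n : ℕ} → Graph n → Graph n → Bool
isSubgraph H G = subVec (bits H) (bits G)

pow2 : ℤ → ℚ
pow2 (+ k) = (+ (2 ^ k)) ℚ./ 1
pow2 -[1+ k ] = (+ 1) ℚ./ (2 ^ suc k)
  where instance _ = m^n≢0 2 (suc k)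

β : ℕ → ℤ → ℤ
β n α = (ℤ.- ((+ (n C 2)) ℤ.* α)) ℤ.- (+ (n C 2)) ℤ.- (+ 1)

-- Σ_f f(H) w_f for TRIFREE(G, α): edge-indicator features (weight α on pairs in E(G),
-- β otherwise) plus the triangle-count feature with weight β.
edgeFeatureSum : {k : ℕ} → ℤ → ℤ → Vec Bool k → Vec Bool k → ℤ
edgeFeatureSum a b [] [] = + 0
edgeFeatureSum a b (g ∷ gs) (h ∷ hs) =
  (if h then (if g then a else b) else + 0) ℤ.+ edgeFeatureSum a b gs hs

logDensity : {n : ℕ} → Graph n → ℤ → Graph n → ℤ
logDensity {n} G α H = edgeFeatureSum α (β n α) (bits G) (bits H) ℤ.+ ((+ triangles H) ℤ.* β n α)

density : {n : ℕ} → Graph n → ℤ → Graph n → ℚ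
density G α H = pow2 (logDensity G α H)

sumℚ : List ℚ → ℚ
sumℚ [] = 0ℚ
sumℚ (x ∷ xs) = x ℚ.+ sumℚ xs

Z : {n : ℕ} → Graph n → ℤ → ℚ
Z {n} G α = sumℚ (map (density G α) (allGraphs n))

digit : {n : ℕ} → Graph n → ℕ → ℕ
digit {n} G i = length (filterᵇ (λ H → isSubgraph H G ∧ (length (edges H) ≡ᵇ i) ∧ triangleFree H) (allGraphs n))

sumTo : ℕ → (ℕ → ℕ) → ℕ
sumTo zero f = f 0
sumTo (suc N) f = sumTo N f ℕ.+ f (suc N)

-- Let N = n C 2.  A triangle-free subgraph H of G has log-density exactly α·|E(H)|.  Any other
-- graph picks up the weight β at least once (an edge outside G, or a triangle) while its remaining
-- terms add up to at most α·N, so with β = -N·α - N - 1 its density is at most 2^-(N+1).  There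
-- are 2^N graphs, so these add up to less than 1: ⌊Z⌋ is the sum of 2^(α·|E(H)|) over the
-- triangle-free subgraphs H of G, which grouped by |E(H)| = i is Σ d_i 2^(iα).  Finally
-- d_i ≤ 2^N < 2^α.
module Submission where

open import Defs
open import Algebra.Bundles using (CommutativeMonoid)
import Algebra.Properties.CommutativeSemigroup as CommutativeSemigroupProperties
open import Data.Bool using (Bool; true; false; _∧_; if_then_else_; T)
open import Data.Bool.Properties using (∧-zeroʳ; ∧-identityʳ)
open import Data.Fin using (Fin; zero; suc; toℕ)
open import Data.List
  using (List; []; _∷_; _++_; length; map; filterᵇ; allFin; cartesianProduct; concatMap)
open import Data.List.Properties
  using (length-++; length-map; length-tabulate; filter-++; filter-all; length-filter; map-tabulate; map-∘; map-cong)
open import Data.List.Relation.Unary.All using (universal)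
open import Data.Nat
open import Data.Nat.Properties
open import Data.Nat.Combinatorics using (_C_; nC1≡n; nCk+nC[k+1]≡[n+1]C[k+1])
open import Data.Nat.Coprimality using (1-coprimeTo) renaming (sym to coprime-sym)
open import Data.Nat.ListAction using (sum)
open import Data.Integer as ℤ using (ℤ; +_; -[1+_]; +≤+; -≤-; -≤+)
import Data.Integer.Properties as ℤP
open import Data.Integer.DivMod using (div-pos-is-/ℕ; [n/ℕd]*d≤n; n<s[n/ℕd]*d)
open import Data.Integer.Tactic.RingSolver using (solve-∀)
open import Data.Product using (_×_; _,_; proj₁; proj₂)
open import Data.Rational as ℚ using (ℚ; mkℚ; floor; toℚᵘ)
import Data.Rational.Properties as ℚP
open import Data.Rational.Unnormalised as ℚᵘ using (ℚᵘ; mkℚᵘ; 0ℚᵘ; 1ℚᵘ; *≤*; *<*; *≡*)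
import Data.Rational.Unnormalised.Properties as ℚᵘP
open import Data.Sum using (inj₁; inj₂)
open import Data.Unit using (tt)
open import Data.Vec using (Vec; []; _∷_; countᵇ)
open import Data.Vec.Properties using (count≤n)
open import Function using (_∘_; id)
open import Relation.Binary.PropositionalEquality
open import Relation.Nullary.Decidable using (T?; dec-true; dec-false)

private variable A B : Set

open CommutativeSemigroupProperties +-commutativeSemigroup using () renaming (interchange to +-interchange)
open CommutativeSemigroupProperties (CommutativeMonoid.commutativeSemigroup ℚᵘP.+-0-commutativeMonoid)
  using () renaming (interchange to ℚᵘ-+-interchange)

𝟙 : Bool → ℕ
𝟙 true = 1
𝟙 false = 0

count : (A → Bool) → List A → ℕ
count p xs = length (filterᵇ p xs)

count-∷ : (p : A → Bool) (x : A) (xs : List A) → count p (x ∷ xs) ≡ 𝟙 (p x) + count p xs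
count-∷ p x xs with p x
... | true = refl
... | false = refl

count-++ : (p : A → Bool) (xs ys : List A) → count p (xs ++ ys) ≡ count p xs + count p ys
count-++ p xs ys = trans (cong length (filter-++ (T? ∘ p) xs ys)) (length-++ (filterᵇ p xs))

count-map : (p : B → Bool) (f : A → B) (xs : List A) → count p (map f xs) ≡ count (p ∘ f) xs
count-map p f [] = refl
count-map p f (x ∷ xs) with p (f x)
... | true = cong suc (count-map p f xs)
... | false = count-map p f xs

count-cartesianProduct : (p : A × B → Bool) (xs : List A) (ys : List B) →
  count p (cartesianProduct xs ys) ≡ sum (map (λ x → count (λ y → p (x , y)) ys) xs)
count-cartesianProduct p [] ys = refl
count-cartesianProduct p (x ∷ xs) ys = trans (count-++ p (map (x ,_) ys) (cartesianProduct xs ys))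
  (cong₂ _+_ (count-map p (x ,_) ys) (count-cartesianProduct p xs ys))

allFin-suc : ∀ n → allFin (suc n) ≡ zero ∷ map suc (allFin n)
allFin-suc n = cong (zero ∷_) (sym (map-tabulate id suc))

above : ∀ n → Fin n → ℕ
above n x = count (λ y → toℕ x <ᵇ toℕ y) (allFin n)

above-zero : ∀ n → above (suc n) zero ≡ n
above-zero n = begin
  above (suc n) zero
    ≡⟨ cong (count (λ y → 0 <ᵇ toℕ y)) (allFin-suc n) ⟩
  count (λ y → 0 <ᵇ toℕ y) (map suc (allFin n))
    ≡⟨ count-map _ suc (allFin n) ⟩
  count (λ _ → true) (allFin n)
    ≡⟨ cong length (filter-all (T? ∘ λ _ → true) (universal _ (allFin n))) ⟩
  length (allFin n)
    ≡⟨ length-tabulate id ⟩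
  n
    ∎
  where open ≡-Reasoning

above-suc : ∀ n x → above (suc n) (suc x) ≡ above n x
above-suc n x = trans (cong (count (λ y → suc (toℕ x) <ᵇ toℕ y)) (allFin-suc n)) (count-map _ suc (allFin n))

length-pairs≡sum-above : ∀ n → length (pairs n) ≡ sum (map (above n) (allFin n))
length-pairs≡sum-above n = count-cartesianProduct _ (allFin n) (allFin n)

length-pairs : ∀ n → length (pairs n) ≡ n C 2
length-pairs zero = refl
length-pairs (suc n) = begin
  length (pairs (suc n))
    ≡⟨ length-pairs≡sum-above (suc n) ⟩
  sum (map (above (suc n)) (allFin (suc n)))
    ≡⟨ cong (sum ∘ map (above (suc n))) (allFin-suc n) ⟩
  above (suc n) zero + sum (map (above (suc n)) (map suc (allFin n)))
    ≡⟨ cong₂ _+_ (above-zero n) (cong sum (sym (map-∘ (allFin n)))) ⟩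
  n + sum (map (above (suc n) ∘ suc) (allFin n))
    ≡⟨ cong (λ xs → n + sum xs) (map-cong (above-suc n) (allFin n)) ⟩
  n + sum (map (above n) (allFin n))
    ≡⟨ cong (λ k → n + k) (trans (sym (length-pairs≡sum-above n)) (length-pairs n)) ⟩
  n + n C 2
    ≡⟨ cong (_+ n C 2) (sym (nC1≡n n)) ⟩
  n C 1 + n C 2
    ≡⟨ nCk+nC[k+1]≡[n+1]C[k+1] n 1 ⟩
  suc n C 2
    ∎
  where open ≡-Reasoning

length-allVecs : ∀ k → length (allVecs k) ≡ 2 ^ k
length-allVecs zero = refl
length-allVecs (suc k) = trans (length-doubled (allVecs k)) (cong (2 *_) (length-allVecs k))
  where
  length-doubled : ∀ {m} (vs : List (Vec Bool m)) →
    length (concatMap (λ (v : Vec Bool m) → (false ∷ v) ∷ (true ∷ v) ∷ []) vs) ≡ 2 * length vs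
  length-doubled [] = refl
  length-doubled (v ∷ vs) = trans (cong (λ k → 2 + k) (length-doubled vs)) (sym (*-suc 2 (length vs)))

length-allGraphs : ∀ n → length (allGraphs n) ≡ 2 ^ length (pairs n)
length-allGraphs n = trans (length-map (mkGraph {n}) (allVecs (length (pairs n)))) (length-allVecs (length (pairs n)))

length-select : (xs : List A) (bs : Vec Bool (length xs)) → length (select xs bs) ≡ countᵇ id bs
length-select [] [] = refl
length-select (x ∷ xs) (true ∷ bs) = cong suc (length-select xs bs)
length-select (x ∷ xs) (false ∷ bs) = length-select xs bs

length-edges≤ : ∀ {n} (H : Graph n) → length (edges H) ≤ n C 2
length-edges≤ {n} H = begin
  length (edges H)     ≡⟨ length-select (pairs n) (bits H) ⟩
  countᵇ id (bits H)   ≤⟨ count≤n (T? ∘ id) (bits H) ⟩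
  length (pairs n)     ≡⟨ length-pairs n ⟩
  n C 2                ∎
  where open ≤-Reasoning

sumTo-cong : ∀ N {f g : ℕ → ℕ} → (∀ i → f i ≡ g i) → sumTo N f ≡ sumTo N g
sumTo-cong zero f≗g = f≗g 0
sumTo-cong (suc N) f≗g = cong₂ _+_ (sumTo-cong N f≗g) (f≗g (suc N))

sumTo-zero : ∀ N → sumTo N (λ _ → 0) ≡ 0
sumTo-zero zero = refl
sumTo-zero (suc N) = cong (_+ 0) (sumTo-zero N)

sumTo-+ : ∀ N (f g : ℕ → ℕ) → sumTo N (λ i → f i + g i) ≡ sumTo N f + sumTo N g
sumTo-+ zero f g = refl
sumTo-+ (suc N) f g = trans (cong (_+ (f (suc N) + g (suc N))) (sumTo-+ N f g))
  (+-interchange (sumTo N f) (sumTo N g) (f (suc N)) (g (suc N)))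

≢⇒≡ᵇ-false : ∀ {m n} → m ≢ n → (m ≡ᵇ n) ≡ false
≢⇒≡ᵇ-false {m} {n} = dec-false (m ≟ n)

sumTo-indicator-> : ∀ N e (W : ℕ → ℕ) → N < e → sumTo N (λ i → 𝟙 (e ≡ᵇ i) * W i) ≡ 0
sumTo-indicator-> zero (suc e) W _ = refl
sumTo-indicator-> (suc N) e W N<e = cong₂ _+_
  (sumTo-indicator-> N e W (<-trans (n<1+n N) N<e))
  (cong (λ b → 𝟙 b * W (suc N)) (≢⇒≡ᵇ-false (>⇒≢ N<e)))

sumTo-indicator : ∀ N e (W : ℕ → ℕ) → e ≤ N → sumTo N (λ i → 𝟙 (e ≡ᵇ i) * W i) ≡ W e
sumTo-indicator zero .zero W z≤n = +-identityʳ (W 0)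
sumTo-indicator (suc N) e W e≤ with m≤n⇒m<n∨m≡n e≤
... | inj₁ e< = trans
  (cong₂ _+_ (sumTo-indicator N e W (s≤s⁻¹ e<))
    (cong (λ b → 𝟙 b * W (suc N)) (≢⇒≡ᵇ-false (<⇒≢ e<))))
  (+-identityʳ (W e))
... | inj₂ refl = trans
  (cong₂ _+_ (sumTo-indicator-> N (suc N) W ≤-refl) (cong (λ b → 𝟙 b * W (suc N)) (dec-true (N ≟ N) refl)))
  (+-identityʳ (W (suc N)))

sumTo-indicator-∧ : ∀ N e s t (W : ℕ → ℕ) → e ≤ N →
  sumTo N (λ i → 𝟙 (s ∧ (e ≡ᵇ i) ∧ t) * W i) ≡ 𝟙 (s ∧ t) * W e
sumTo-indicator-∧ N e false t W _ = sumTo-zero N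
sumTo-indicator-∧ N e true false W _ =
  trans (sumTo-cong N (λ i → cong (λ b → 𝟙 b * W i) (∧-zeroʳ (e ≡ᵇ i)))) (sumTo-zero N)
sumTo-indicator-∧ N e true true W e≤N =
  trans (sumTo-cong N (λ i → cong (λ b → 𝟙 b * W i) (∧-identityʳ (e ≡ᵇ i))))
    (trans (sumTo-indicator N e W e≤N) (sym (+-identityʳ (W e))))

sumTo-count : ∀ N (P : ℕ → A → Bool) (W : ℕ → ℕ) (w : A → ℕ) →
  (∀ x → sumTo N (λ i → 𝟙 (P i x) * W i) ≡ w x) →
  ∀ xs → sumTo N (λ i → count (P i) xs * W i) ≡ sum (map w xs)
sumTo-count N P W w point [] = sumTo-zero N
sumTo-count N P W w point (x ∷ xs) = begin
  sumTo N (λ i → count (P i) (x ∷ xs) * W i)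
    ≡⟨ sumTo-cong N (λ i → trans (cong (_* W i) (count-∷ (P i) x xs)) (*-distribʳ-+ (W i) (𝟙 (P i x)) _)) ⟩
  sumTo N (λ i → 𝟙 (P i x) * W i + count (P i) xs * W i)
    ≡⟨ sumTo-+ N _ _ ⟩
  sumTo N (λ i → 𝟙 (P i x) * W i) + sumTo N (λ i → count (P i) xs * W i)
    ≡⟨ cong₂ _+_ (point x) (sumTo-count N P W w point xs) ⟩
  w x + sum (map w xs)
    ∎
  where open ≡-Reasoning

edgeFeatureSum-subgraph : ∀ {k} a b (gs hs : Vec Bool k) → subVec hs gs ≡ true →
  edgeFeatureSum (+ a) b gs hs ≡ + (countᵇ id hs * a)
edgeFeatureSum-subgraph a b [] [] _ = refl
edgeFeatureSum-subgraph a b (g ∷ gs) (false ∷ hs) sub =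
  trans (ℤP.+-identityˡ _) (edgeFeatureSum-subgraph a b gs hs sub)
edgeFeatureSum-subgraph a b (true ∷ gs) (true ∷ hs) sub =
  trans (cong (ℤ._+_ (+ a)) (edgeFeatureSum-subgraph a b gs hs sub)) (sym (ℤP.pos-+ a _))
edgeFeatureSum-subgraph a b (false ∷ gs) (true ∷ hs) ()

edgeFeatureSum≤ : ∀ {k} a M (gs hs : Vec Bool k) → edgeFeatureSum (+ a) -[1+ M ] gs hs ℤ.≤ + (k * a)
edgeFeatureSum≤ a M [] [] = +≤+ z≤n
edgeFeatureSum≤ {suc k} a M (g ∷ gs) (h ∷ hs) =
  ℤP.≤-trans (ℤP.+-mono-≤ (term≤ g h) (edgeFeatureSum≤ a M gs hs))
    (ℤP.≤-reflexive (sym (ℤP.pos-+ a (k * a))))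
  where
  term≤ : ∀ g h → (if h then (if g then + a else -[1+ M ]) else + 0) ℤ.≤ + a
  term≤ g false = +≤+ z≤n
  term≤ true true = ℤP.≤-refl
  term≤ false true = -≤+

+-mono-≤-reassoc : ∀ {x y} a c b → x ℤ.≤ + a → y ℤ.≤ + c ℤ.+ b → x ℤ.+ y ℤ.≤ + (a + c) ℤ.+ b
+-mono-≤-reassoc {x} {y} a c b x≤a y≤c+b = begin
  x ℤ.+ y                   ≤⟨ ℤP.+-mono-≤ x≤a y≤c+b ⟩
  + a ℤ.+ (+ c ℤ.+ b)       ≡⟨ sym (ℤP.+-assoc (+ a) (+ c) b) ⟩
  + a ℤ.+ + c ℤ.+ b         ≡⟨ cong (ℤ._+ b) (sym (ℤP.pos-+ a c)) ⟩
  + (a + c) ℤ.+ b           ∎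
  where open ℤP.≤-Reasoning

edgeFeatureSum-nonSubgraph : ∀ {k} a M (gs hs : Vec Bool k) → subVec hs gs ≡ false →
  edgeFeatureSum (+ a) -[1+ M ] gs hs ℤ.≤ + (k * a) ℤ.+ -[1+ M ]
edgeFeatureSum-nonSubgraph a M [] [] ()
edgeFeatureSum-nonSubgraph {suc k} a M (g ∷ gs) (false ∷ hs) ns =
  +-mono-≤-reassoc a (k * a) -[1+ M ] (+≤+ z≤n) (edgeFeatureSum-nonSubgraph a M gs hs ns)
edgeFeatureSum-nonSubgraph {suc k} a M (true ∷ gs) (true ∷ hs) ns =
  +-mono-≤-reassoc a (k * a) -[1+ M ] ℤP.≤-refl (edgeFeatureSum-nonSubgraph a M gs hs ns)
edgeFeatureSum-nonSubgraph {suc k} a M (false ∷ gs) (true ∷ hs) _ = begin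
  -[1+ M ] ℤ.+ edgeFeatureSum (+ a) -[1+ M ] gs hs  ≤⟨ ℤP.+-monoʳ-≤ -[1+ M ] (edgeFeatureSum≤ a M gs hs) ⟩
  -[1+ M ] ℤ.+ + (k * a)                             ≤⟨ ℤP.+-monoʳ-≤ -[1+ M ] (+≤+ (m≤n+m (k * a) a)) ⟩
  -[1+ M ] ℤ.+ + (a + k * a)                         ≡⟨ ℤP.+-comm -[1+ M ] (+ (a + k * a)) ⟩
  + (a + k * a) ℤ.+ -[1+ M ]                         ∎
  where open ℤP.≤-Reasoning

β≡-[1+_] : ∀ n a → β n (+ a) ≡ -[1+ (n C 2) * a + n C 2 ]
β≡-[1+_] n a = begin
  ℤ.- (+ N ℤ.* + a) ℤ.- + N ℤ.- + 1
    ≡⟨ negated (+ N) (+ a) ⟩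
  ℤ.- (+ 1 ℤ.+ (+ N ℤ.* + a ℤ.+ + N))
    ≡⟨ cong (λ x → ℤ.- (+ 1 ℤ.+ x)) (sym (trans (ℤP.pos-+ (N * a) N) (cong (ℤ._+ + N) (ℤP.pos-* N a)))) ⟩
  -[1+ N * a + N ]
    ∎
  where
  open ≡-Reasoning
  N = n C 2
  negated : ∀ x y → ℤ.- (x ℤ.* y) ℤ.- x ℤ.- ℤ.1ℤ ≡ ℤ.- (ℤ.1ℤ ℤ.+ (x ℤ.* y ℤ.+ x))
  negated = solve-∀

+m+-[1+m+n]≡-[1+n] : ∀ m n → + m ℤ.+ -[1+ m + n ] ≡ -[1+ n ]
+m+-[1+m+n]≡-[1+n] zero n = refl
+m+-[1+m+n]≡-[1+n] (suc m) n = trans (ℤP.[1+m]⊖[1+n]≡m⊖n m (suc (m + n))) (+m+-[1+m+n]≡-[1+n] m n)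

+[m*a]+-[1+N*a+N]≤-[1+m] : ∀ {m N} a → m ≤ N → + (m * a) ℤ.+ -[1+ N * a + N ] ℤ.≤ -[1+ m ]
+[m*a]+-[1+N*a+N]≤-[1+m] {m} {N} a m≤N = begin
  + (m * a) ℤ.+ -[1+ N * a + N ]         ≤⟨ ℤP.+-monoˡ-≤ -[1+ N * a + N ] (+≤+ (*-monoˡ-≤ a m≤N)) ⟩
  + (N * a) ℤ.+ -[1+ N * a + N ]         ≡⟨ +m+-[1+m+n]≡-[1+n] (N * a) N ⟩
  -[1+ N ]                               ≤⟨ -≤- m≤N ⟩
  -[1+ m ]                               ∎
  where open ℤP.≤-Reasoning

logDensity-β : ∀ {n} (G H : Graph n) a → let M = (n C 2) * a + n C 2 in
  logDensity G (+ a) H ≡ edgeFeatureSum (+ a) -[1+ M ] (bits G) (bits H) ℤ.+ + triangles H ℤ.* -[1+ M ]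
logDensity-β {n} G H a =
  cong (λ b → edgeFeatureSum (+ a) b (bits G) (bits H) ℤ.+ + triangles H ℤ.* b) (β≡-[1+_] n a)

logDensity-triangleFreeSubgraph : ∀ {n} (G H : Graph n) a → isSubgraph H G ≡ true → triangleFree H ≡ true →
  logDensity G (+ a) H ≡ + (length (edges H) * a)
logDensity-triangleFreeSubgraph {n} G H a sub tf = begin
  edgeFeatureSum (+ a) b (bits G) (bits H) ℤ.+ + triangles H ℤ.* b
    ≡⟨ cong (λ t → edgeFeatureSum (+ a) b (bits G) (bits H) ℤ.+ + t ℤ.* b) no-triangles ⟩
  edgeFeatureSum (+ a) b (bits G) (bits H) ℤ.+ + 0 ℤ.* b
    ≡⟨ cong (ℤ._+_ (edgeFeatureSum (+ a) b (bits G) (bits H))) (ℤP.*-zeroˡ b) ⟩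
  edgeFeatureSum (+ a) b (bits G) (bits H) ℤ.+ + 0
    ≡⟨ ℤP.+-identityʳ _ ⟩
  edgeFeatureSum (+ a) b (bits G) (bits H)
    ≡⟨ edgeFeatureSum-subgraph a b (bits G) (bits H) sub ⟩
  + (countᵇ id (bits H) * a)
    ≡⟨ cong (λ m → + (m * a)) (sym (length-select (pairs n) (bits H))) ⟩
  + (length (edges H) * a)
    ∎
  where
  open ≡-Reasoning
  b = β n (+ a)
  no-triangles : triangles H ≡ 0
  no-triangles = ≡ᵇ⇒≡ (triangles H) 0 (subst T (sym tf) tt)

logDensity-nonSubgraph : ∀ {n} (G H : Graph n) a → isSubgraph H G ≡ false →
  logDensity G (+ a) H ℤ.≤ -[1+ length (pairs n) ]
logDensity-nonSubgraph {n} G H a ns = begin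
  logDensity G (+ a) H
    ≡⟨ logDensity-β G H a ⟩
  edgeFeatureSum (+ a) -[1+ M ] (bits G) (bits H) ℤ.+ + triangles H ℤ.* -[1+ M ]
    ≤⟨ ℤP.+-mono-≤ (edgeFeatureSum-nonSubgraph a M (bits G) (bits H) ns) (triangles-nonPositive (triangles H)) ⟩
  + (L * a) ℤ.+ -[1+ M ] ℤ.+ + 0
    ≡⟨ ℤP.+-identityʳ _ ⟩
  + (L * a) ℤ.+ -[1+ M ]
    ≤⟨ +[m*a]+-[1+N*a+N]≤-[1+m] a (≤-reflexive (length-pairs n)) ⟩
  -[1+ L ]
    ∎
  where
  open ℤP.≤-Reasoning
  L = length (pairs n)
  M = (n C 2) * a + n C 2
  triangles-nonPositive : ∀ t → + t ℤ.* -[1+ M ] ℤ.≤ + 0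
  triangles-nonPositive zero = ℤP.≤-refl
  triangles-nonPositive (suc t) = -≤+

logDensity-triangle : ∀ {n} (G H : Graph n) a → triangleFree H ≡ false →
  logDensity G (+ a) H ℤ.≤ -[1+ length (pairs n) ]
logDensity-triangle {n} G H a tf = begin
  logDensity G (+ a) H
    ≡⟨ logDensity-β G H a ⟩
  edgeFeatureSum (+ a) -[1+ M ] (bits G) (bits H) ℤ.+ + triangles H ℤ.* -[1+ M ]
    ≤⟨ ℤP.+-mono-≤ (edgeFeatureSum≤ a M (bits G) (bits H)) (triangles-penalty (triangles H) tf) ⟩
  + (L * a) ℤ.+ -[1+ M ]
    ≤⟨ +[m*a]+-[1+N*a+N]≤-[1+m] a (≤-reflexive (length-pairs n)) ⟩
  -[1+ L ]
    ∎
  where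
  open ℤP.≤-Reasoning
  L = length (pairs n)
  M = (n C 2) * a + n C 2
  triangles-penalty : ∀ t → (t ≡ᵇ 0) ≡ false → + t ℤ.* -[1+ M ] ℤ.≤ -[1+ M ]
  triangles-penalty (suc t) _ = -≤- (m≤m+n M _)

fromℕᵘ : ℕ → ℚᵘ
fromℕᵘ m = mkℚᵘ (+ m) 0

fromℕᵘ-+ : ∀ m n → fromℕᵘ (m + n) ℚᵘ.≃ fromℕᵘ m ℚᵘ.+ fromℕᵘ n
fromℕᵘ-+ m n = *≡* (cong (ℤ._* + 1) (trans (ℤP.pos-+ m n)
  (cong₂ ℤ._+_ (sym (ℤP.*-identityʳ (+ m))) (sym (ℤP.*-identityʳ (+ n))))))

mkℚᵘ-suc : ∀ m d → mkℚᵘ (+ 1) d ℚᵘ.+ mkℚᵘ (+ m) d ℚᵘ.≃ mkℚᵘ (+ suc m) d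
mkℚᵘ-suc m d = *≡* (trans (common-denominator (+ suc d) (+ m))
  (cong₂ ℤ._*_ (sym (ℤP.pos-+ 1 m)) (sym (ℤP.pos-* (suc d) (suc d)))))
  where
  common-denominator : ∀ (e x : ℤ) → (ℤ.1ℤ ℤ.* e ℤ.+ x ℤ.* e) ℤ.* e ≡ (ℤ.1ℤ ℤ.+ x) ℤ.* (e ℤ.* e)
  common-denominator = solve-∀

mkℚᵘ<1 : ∀ {m d} → m ≤ d → mkℚᵘ (+ m) d ℚᵘ.< 1ℚᵘ
mkℚᵘ<1 {m} {d} m≤d =
  *<* (subst₂ ℤ._<_ (sym (ℤP.*-identityʳ (+ m))) (sym (ℤP.*-identityˡ (+ suc d))) (ℤ.+<+ (s≤s m≤d)))

1/suc-antitone : ∀ {d e} → d ≤ e → mkℚᵘ (+ 1) e ℚᵘ.≤ mkℚᵘ (+ 1) d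
1/suc-antitone {d} {e} d≤e =
  *≤* (subst₂ ℤ._≤_ (sym (ℤP.*-identityˡ _)) (sym (ℤP.*-identityˡ _)) (+≤+ (s≤s d≤e)))

toℚᵘ-m/1 : ∀ m → toℚᵘ ((+ m) ℚ./ 1) ≡ fromℕᵘ m
toℚᵘ-m/1 m = cong toℚᵘ (ℚP.normalize-coprime {m} {0} (coprime-sym (1-coprimeTo m)))

toℚᵘ-1/d : ∀ d .{{_ : NonZero d}} → toℚᵘ ((+ 1) ℚ./ d) ≡ mkℚᵘ (+ 1) (pred d)
toℚᵘ-1/d (suc d) = cong toℚᵘ (ℚP.normalize-coprime (1-coprimeTo (suc d)))

toℚᵘ-pow2-nonNegative : ∀ z → 0ℚᵘ ℚᵘ.≤ toℚᵘ (pow2 z)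
toℚᵘ-pow2-nonNegative (+ m) rewrite toℚᵘ-m/1 (2 ^ m) = ℚᵘP.nonNegative⁻¹ (fromℕᵘ (2 ^ m))
toℚᵘ-pow2-nonNegative -[1+ k ] rewrite toℚᵘ-1/d (2 ^ suc k) {{m^n≢0 2 (suc k)}} =
  ℚᵘP.nonNegative⁻¹ (mkℚᵘ (+ 1) (pred (2 ^ suc k)))

-- m / 2^(L+1); mkℚᵘ stores the denominator minus one.
infix 7 _/2^suc_
_/2^suc_ : ℕ → ℕ → ℚᵘ
m /2^suc L = mkℚᵘ (+ m) (pred (2 ^ suc L))

toℚᵘ-pow2-≤ : ∀ {z L} → z ℤ.≤ -[1+ L ] → toℚᵘ (pow2 z) ℚᵘ.≤ 1 /2^suc L
toℚᵘ-pow2-≤ { -[1+ k ]} {L} (-≤- L≤k) rewrite toℚᵘ-1/d (2 ^ suc k) {{m^n≢0 2 (suc k)}} =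
  1/suc-antitone (pred-mono-≤ (^-monoʳ-≤ 2 (s≤s L≤k)))

floor-unique : ∀ (i : ℤ) (q : ℚ) →
  mkℚᵘ i 0 ℚᵘ.≤ toℚᵘ q → toℚᵘ q ℚᵘ.< mkℚᵘ (ℤ.suc i) 0 → floor q ≡ i
floor-unique i (mkℚ num d-1 _) (*≤* lower) (*<* upper) =
  trans (div-pos-is-/ℕ num d) (ℤP.≤-antisym ⌊q⌋≤i i≤⌊q⌋)
  where
  d = suc d-1
  ⌊q⌋ = num ℤ./ℕ d
  i<suc⌊q⌋ : i ℤ.< ℤ.suc ⌊q⌋
  i<suc⌊q⌋ = ℤP.*-cancelʳ-<-nonNeg (+ d)
    (ℤP.≤-<-trans (subst (i ℤ.* + d ℤ.≤_) (ℤP.*-identityʳ num) lower) (n<s[n/ℕd]*d num d))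
  ⌊q⌋<suc-i : ⌊q⌋ ℤ.< ℤ.suc i
  ⌊q⌋<suc-i = ℤP.*-cancelʳ-<-nonNeg (+ d)
    (ℤP.≤-<-trans ([n/ℕd]*d≤n num d) (subst (ℤ._< ℤ.suc i ℤ.* + d) (ℤP.*-identityʳ num) upper))
  i≤⌊q⌋ : i ℤ.≤ ⌊q⌋
  i≤⌊q⌋ = subst (i ℤ.≤_) (ℤP.pred-suc ⌊q⌋) (ℤP.i<j⇒i≤pred[j] i<suc⌊q⌋)
  ⌊q⌋≤i : ⌊q⌋ ℤ.≤ i
  ⌊q⌋≤i = subst (⌊q⌋ ℤ.≤_) (ℤP.pred-suc i) (ℤP.i<j⇒i≤pred[j] ⌊q⌋<suc-i)

sumℚ-lower : (f : A → ℚ) (w : A → ℕ) → (∀ x → fromℕᵘ (w x) ℚᵘ.≤ toℚᵘ (f x)) →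
  ∀ xs → fromℕᵘ (sum (map w xs)) ℚᵘ.≤ toℚᵘ (sumℚ (map f xs))
sumℚ-lower f w w≤f [] = ℚᵘP.≤-refl
sumℚ-lower f w w≤f (x ∷ xs) = begin
  fromℕᵘ (w x + sum (map w xs))                   ≃⟨ fromℕᵘ-+ (w x) _ ⟩
  fromℕᵘ (w x) ℚᵘ.+ fromℕᵘ (sum (map w xs))      ≤⟨ ℚᵘP.+-mono-≤ (w≤f x) (sumℚ-lower f w w≤f xs) ⟩
  toℚᵘ (f x) ℚᵘ.+ toℚᵘ (sumℚ (map f xs))         ≃⟨ ℚᵘP.≃-sym (ℚP.toℚᵘ-homo-+ (f x) _) ⟩
  toℚᵘ (f x ℚ.+ sumℚ (map f xs))                  ∎
  where open ℚᵘP.≤-Reasoning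

sumℚ-upper : (f : A → ℚ) (w : A → ℕ) (d : ℕ) →
  (∀ x → toℚᵘ (f x) ℚᵘ.≤ fromℕᵘ (w x) ℚᵘ.+ mkℚᵘ (+ 1) d) →
  ∀ xs → toℚᵘ (sumℚ (map f xs)) ℚᵘ.≤ fromℕᵘ (sum (map w xs)) ℚᵘ.+ mkℚᵘ (+ length xs) d
sumℚ-upper f w d f≤w+ε [] = ℚᵘP.nonNegative⁻¹ (fromℕᵘ 0 ℚᵘ.+ mkℚᵘ (+ 0) d)
sumℚ-upper f w d f≤w+ε (x ∷ xs) = begin
  toℚᵘ (f x ℚ.+ sumℚ (map f xs))
    ≃⟨ ℚP.toℚᵘ-homo-+ (f x) _ ⟩
  toℚᵘ (f x) ℚᵘ.+ toℚᵘ (sumℚ (map f xs))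
    ≤⟨ ℚᵘP.+-mono-≤ (f≤w+ε x) (sumℚ-upper f w d f≤w+ε xs) ⟩
  (fromℕᵘ (w x) ℚᵘ.+ mkℚᵘ (+ 1) d) ℚᵘ.+ (fromℕᵘ S ℚᵘ.+ mkℚᵘ (+ m) d)
    ≃⟨ ℚᵘ-+-interchange (fromℕᵘ (w x)) (mkℚᵘ (+ 1) d) (fromℕᵘ S) (mkℚᵘ (+ m) d) ⟩
  (fromℕᵘ (w x) ℚᵘ.+ fromℕᵘ S) ℚᵘ.+ (mkℚᵘ (+ 1) d ℚᵘ.+ mkℚᵘ (+ m) d)
    ≃⟨ ℚᵘP.+-cong (ℚᵘP.≃-sym (fromℕᵘ-+ (w x) S)) (mkℚᵘ-suc m d) ⟩
  fromℕᵘ (w x + S) ℚᵘ.+ mkℚᵘ (+ suc m) d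
    ∎
  where
  open ℚᵘP.≤-Reasoning
  S = sum (map w xs)
  m = length xs

toℚᵘ-pow2-negligible : ∀ {z L} → z ℤ.≤ -[1+ L ] →
  0ℚᵘ ℚᵘ.≤ toℚᵘ (pow2 z) × toℚᵘ (pow2 z) ℚᵘ.≤ 0ℚᵘ ℚᵘ.+ 1 /2^suc L
toℚᵘ-pow2-negligible {z} {L} z≤ = toℚᵘ-pow2-nonNegative z ,
  ℚᵘP.≤-trans (toℚᵘ-pow2-≤ z≤) (ℚᵘP.≤-reflexive-≡ (sym (ℚᵘP.+-identityˡ-≡ (1 /2^suc L))))

weight : ∀ {n} → Graph n → ℕ → Graph n → ℕ
weight G α H = 𝟙 (isSubgraph H G ∧ triangleFree H) * 2 ^ (length (edges H) * α)

density-bounds : ∀ {n} (G H : Graph n) α →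
  fromℕᵘ (weight G α H) ℚᵘ.≤ toℚᵘ (density G (+ α) H)
  × toℚᵘ (density G (+ α) H) ℚᵘ.≤ fromℕᵘ (weight G α H) ℚᵘ.+ 1 /2^suc length (pairs n)
density-bounds {n} G H α with isSubgraph H G in sub | triangleFree H in tf
... | true | true = ℚᵘP.≤-reflexive-≡ (sym exact) ,
  ℚᵘP.≤-trans (ℚᵘP.≤-reflexive-≡ exact) (ℚᵘP.p≤p+q _ (1 /2^suc length (pairs n)))
  where
  exact : toℚᵘ (density G (+ α) H) ≡ fromℕᵘ (1 * 2 ^ (length (edges H) * α))
  exact = trans (cong (toℚᵘ ∘ pow2) (logDensity-triangleFreeSubgraph G H α sub tf))
    (trans (toℚᵘ-m/1 _) (cong fromℕᵘ (sym (*-identityˡ _))))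
... | false | _ = toℚᵘ-pow2-negligible (logDensity-nonSubgraph G H α sub)
... | true | false = toℚᵘ-pow2-negligible (logDensity-triangle G H α tf)

sum-weight≡digit-sum : ∀ {n} (G : Graph n) α →
  sum (map (weight G α) (allGraphs n)) ≡ sumTo (n C 2) (λ i → digit G i * 2 ^ (i * α))
sum-weight≡digit-sum {n} G α = sym (sumTo-count (n C 2) digitPredicate 2^[i*α] (weight G α) point (allGraphs n))
  where
  digitPredicate : ℕ → Graph n → Bool
  digitPredicate i H = isSubgraph H G ∧ (length (edges H) ≡ᵇ i) ∧ triangleFree H
  2^[i*α] : ℕ → ℕ
  2^[i*α] i = 2 ^ (i * α)
  point : ∀ H → sumTo (n C 2) (λ i → 𝟙 (digitPredicate i H) * 2^[i*α] i) ≡ weight G α H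
  point H = sumTo-indicator-∧ (n C 2) (length (edges H)) (isSubgraph H G) (triangleFree H) 2^[i*α]
    (length-edges≤ H)

floor-Z≡sum-weight : ∀ {n} (G : Graph n) α → floor (Z G (+ α)) ≡ + sum (map (weight G α) (allGraphs n))
floor-Z≡sum-weight {n} G α = floor-unique (+ W) (Z G (+ α))
  (sumℚ-lower (density G (+ α)) (weight G α) (λ H → proj₁ (density-bounds G H α)) (allGraphs n))
  (begin-strict
    toℚᵘ (Z G (+ α))
      ≤⟨ sumℚ-upper (density G (+ α)) (weight G α) _ (λ H → proj₂ (density-bounds G H α)) (allGraphs n) ⟩
    fromℕᵘ W ℚᵘ.+ length (allGraphs n) /2^suc L
      ≡⟨ cong (λ m → fromℕᵘ W ℚᵘ.+ m /2^suc L) (length-allGraphs n) ⟩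
    fromℕᵘ W ℚᵘ.+ 2 ^ L /2^suc L
      <⟨ ℚᵘP.+-monoʳ-< (fromℕᵘ W) (mkℚᵘ<1 (<⇒≤pred 2^L<2^sucL)) ⟩
    fromℕᵘ W ℚᵘ.+ fromℕᵘ 1
      ≃⟨ ℚᵘP.≃-sym (fromℕᵘ-+ W 1) ⟩
    fromℕᵘ (W + 1)
      ≡⟨ cong fromℕᵘ (+-comm W 1) ⟩
    fromℕᵘ (suc W)
      ∎)
  where
  open ℚᵘP.≤-Reasoning
  L = length (pairs n)
  W = sum (map (weight G α) (allGraphs n))
  2^L<2^sucL : 2 ^ L < 2 ^ suc L
  2^L<2^sucL = ^-monoʳ-< 2 (s≤s (s≤s z≤n)) (n<1+n L)

lemma1 : (n : ℕ) (G : Graph n) (α : ℕ) → n C 2 < α →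
    (floor (Z G (+ α)) ≡ + sumTo (n C 2) (λ i → digit G i * 2 ^ (i * α)))
    × (∀ i → i ≤ n C 2 → digit G i < 2 ^ α)
lemma1 n G α N<α = floor-Z , digit<2^α
  where
  floor-Z : floor (Z G (+ α)) ≡ + sumTo (n C 2) (λ i → digit G i * 2 ^ (i * α))
  floor-Z = trans (floor-Z≡sum-weight G α) (cong +_ (sum-weight≡digit-sum G α))
  digit<2^α : ∀ i → i ≤ n C 2 → digit G i < 2 ^ α
  digit<2^α i _ = begin-strict
    digit G i                ≤⟨ length-filter _ (allGraphs n) ⟩
    length (allGraphs n)     ≡⟨ length-allGraphs n ⟩
    2 ^ length (pairs n)     ≡⟨ cong (2 ^_) (length-pairs n) ⟩
    2 ^ (n C 2)              <⟨ ^-monoʳ-< 2 (s≤s (s≤s z≤n)) N<α ⟩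
    2 ^ α                    ∎
    where open ≤-Reasoning
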